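{- For all PCoR* terms $t, s$ over $\Sigma$: $\mathsf{REL}^{\mathrm{tests}_{B,\bar B}, \mathrm{noms}_L} \models t \le s$ if and only if $\mathsf{REL}^{\mathrm{tests}_{B,\bar B}, \mathrm{noms}_L}_{\mathrm{pw} \le \mathrm{iw}(t) + \#L} \models t \le s$.
   Context: Let $\Sigma$ be a set of variables containing pairwise disjoint finite subsets $B$, $\bar B=\{\bar b : b\in B\}$ (one fresh variable $\bar b$ for each $b\in B$), and $L$. PCoR* terms over $\Sigma$: $t ::= a \mid 1 \mid 0 \mid \top \mid t;t \mid t+t \mid t\cap t \mid t^{\smile}\mid t^{*}$, $a\in\Sigma$. A structure $S$ is a non-empty set $|S|$ with $a^S\subseteq|S|^2$ for each $a\in\Sigma$; semantics $[\![a]\!]_S=a^S$, $[\![1]\!]_S=\triangle_{|S|}$ (identity), $[\![0]\!]_S=\emptyset$, $[\![\top]\!]_S=|S|^2$, and $;,+,\cap,{}^{\smile},{}^{*}$ are composition, union, intersection, converse, reflexive-transitive closure. $\mathsf{REL}^{\mathrm{tests}_{B,\bar B},\mathrm{noms}_L}$ is the class of structures $S$ such that for every $b\in B$, $b^S\cap\bar b^S=\emptyset$ and $b^S\cup\bar b^S=\triangle_{|S|}$, and for every $l\in L$ there is $x\in|S|$ with $l^S=\{(x,x)\}$. Intersection width: $\mathrm{iw}(u)=1$ for $u\in\Sigma\cup\{1,0,\top\}$, $\mathrm{iw}(t^{\smile})=\mathrm{iw}(t^{*})=\mathrm{iw}(t)$, $\mathrm{iw}(t;s)=\mathrm{iw}(t+s)=\max$,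 $\mathrm{iw}(t\cap s)=\mathrm{iw}(t)+\mathrm{iw}(s)$. A path decomposition of a finite structure $S$ is a sequence $(U_1,\dots,U_n)$ of subsets of $|S|$ covering $|S|$, with every $(x,y)\in a^S$ inside some $U_i$ and $U_i\cap U_k\subseteq U_j$ for $i\le j\le k$; its width is $\max_i(\#U_i-1)$ and $\mathrm{pw}(S)$ is the minimal width. For a class $\mathcal C$, $\mathcal C_{\mathrm{pw}\le m}$ is the subclass of finite structures with $\mathrm{pw}\le m$, and $\mathcal C\models t\le s$ means $[\![t]\!]_S\subseteq[\![s]\!]_S$ for all $S\in\mathcal C$. -}

module Defs where

open import Data.Nat using (ℕ; zero; suc; _+_; _∸_; _⊔_; _≤_)
open import Data.Fin using (Fin)
import Data.Fin as F
open import Data.Fin.Subset using (Subset; _∈_; ∣_∣)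
open import Data.List using (List; length; lookup; map; foldr)
open import Data.Product using (Σ; ∃; _×_; _,_)
open import Data.Sum using (_⊎_)
open import Data.Unit using (⊤)
open import Data.Empty using (⊥)
open import Relation.Binary.PropositionalEquality using (_≡_)
open import Relation.Binary.Construct.Closure.ReflexiveTransitive using (Star)
open import Function.Bundles using (_⇔_)

-- The variable set Σ = V ⊎ B ⊎ B̄ ⊎ L, with B ≅ Fin nb, B̄ = {b̄ | b ∈ B},
-- L ≅ Fin nl (pairwise disjoint finite subsets), V the other variables.

data Var (V : Set) (nb nl : ℕ) : Set where
  var : V → Var V nb nl
  tst : Fin nb → Var V nb nl
  ntst : Fin nb → Var V nb nl
  nom : Fin nl → Var V nb nl

data Term (X : Set) : Set where
  atom : X → Term X
  one zero top : Term X
  _⨾_ _⊕_ _∩_ : Term X → Term X → Term X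
  _˘ _* : Term X → Term X

iw : {X : Set} → Term X → ℕ
iw (atom _) = 1
iw one = 1
iw zero = 1
iw top = 1
iw (t ⨾ s) = iw t ⊔ iw s
iw (t ⊕ s) = iw t ⊔ iw s
iw (t ∩ s) = iw t + iw s
iw (t ˘) = iw t
iw (t *) = iw t

record Structure (X : Set) : Set₁ where
  field
    Carrier : Set
    point   : Carrier
    rel     : X → Carrier → Carrier → Set

open Structure public

⟦_⟧ : {X : Set} → Term X → (S : Structure X) → Carrier S → Carrier S → Set
⟦ atom a ⟧ S x y = rel S a x y
⟦ one ⟧ S x y = x ≡ y
⟦ zero ⟧ S x y = ⊥
⟦ top ⟧ S x y = ⊤
⟦ t ⨾ s ⟧ S x y = ∃ λ z → ⟦ t ⟧ S x z × ⟦ s ⟧ S z y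
⟦ t ⊕ s ⟧ S x y = ⟦ t ⟧ S x y ⊎ ⟦ s ⟧ S x y
⟦ t ∩ s ⟧ S x y = ⟦ t ⟧ S x y × ⟦ s ⟧ S x y
⟦ t ˘ ⟧ S x y = ⟦ t ⟧ S y x
⟦ t * ⟧ S x y = Star (⟦ t ⟧ S) x y

record IsRELTestsNoms {V : Set} {nb nl : ℕ} (S : Structure (Var V nb nl)) : Set where
  field
    tests-disjoint : ∀ (b : Fin nb) x y → rel S (tst b) x y → rel S (ntst b) x y → ⊥
    tests-cover    : ∀ (b : Fin nb) x y → (rel S (tst b) x y ⊎ rel S (ntst b) x y) ⇔ (x ≡ y)
    noms-singleton : ∀ (l : Fin nl) → ∃ λ x → ∀ y z → rel S (nom l) y z ⇔ (y ≡ x × z ≡ x)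

Holds≤ : {X : Set} → Structure X → Term X → Term X → Set
Holds≤ S t s = ∀ x y → ⟦ t ⟧ S x y → ⟦ s ⟧ S x y

finStructure : {X : Set} (k : ℕ) → (X → Fin (suc k) → Fin (suc k) → Set) → Structure X
finStructure k r = record { Carrier = Fin (suc k) ; point = F.zero ; rel = r }

record PathDecomposition {X : Set} (k : ℕ) (r : X → Fin (suc k) → Fin (suc k) → Set) : Set where
  field
    bags   : List (Subset (suc k))
    cover  : ∀ x → ∃ λ (i : Fin (length bags)) → x ∈ lookup bags i
    edges  : ∀ a x y → r a x y →
             ∃ λ (i : Fin (length bags)) → x ∈ lookup bags i × y ∈ lookup bags i
    interp : ∀ (i j l : Fin (length bags)) → i F.≤ j → j F.≤ l →
             ∀ x → x ∈ lookup bags i → x ∈ lookup bags l → x ∈ lookup bags j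

-- width = max_i (#U_i - 1)   (truncated subtraction; harmless since some bag is non-empty)
width : {X : Set} {k : ℕ} {r : X → Fin (suc k) → Fin (suc k) → Set} →
        PathDecomposition k r → ℕ
width d = foldr _⊔_ 0 (map (λ U → ∣ U ∣ ∸ 1) (PathDecomposition.bags d))

PathwidthAtMost : {X : Set} (k : ℕ) → (X → Fin (suc k) → Fin (suc k) → Set) → ℕ → Set
PathwidthAtMost k r m = Σ (PathDecomposition k r) λ d → width d ≤ m

-- A witness of x ⟦ t ⟧ y in S is unfolded, along its derivation, into a finite graph on ℕ with a
-- valuation into S: a fresh vertex for every intermediate point of a composition or an iteration,
-- an edge for every variable or test, and an equation for every 1, test and nominal. The vertices
-- carry a path decomposition built along t: composition and iteration concatenate the
-- decompositions of the parts, intersection does the same after adding the input to every bag of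
-- the first part and the output to every bag of the second, and converse reverses; so every bag
-- has at most iw t + 1 vertices. Once the nominal vertices are added to every bag, each equation
-- relates two vertices sharing a bag, and identifying them one pair at a time keeps the
-- decomposition. The quotient, with the relations of S pulled back along the valuation, is a
-- finite structure of the class of pathwidth at most iw t + #L in which t holds between the
-- ends, and it maps homomorphically to S; so every s holding there holds between x and y.

module Submission where

open import Defs
open import Data.Nat using (ℕ; zero; suc; _+_; _∸_; _⊔_; pred; _≤_; _<_; z≤n; s≤s; _<?_; _≟_; >-nonZero)
open import Data.Nat.Properties
open import Data.Nat.DivMod using (_mod_; m<n⇒m%n≡m)
open import Data.Fin using (Fin; toℕ; fromℕ<) renaming (zero to fzero; suc to fsuc)
import Data.Fin.Properties as Fin
open import Data.Fin.Subset using (Subset; ⁅_⁆; _∪_; ⋃; ∣_∣) renaming (_∈_ to _∈ˢ_)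
open import Data.Fin.Subset.Properties using (x∈⁅x⁆; x∈⁅y⁆⇒x≡y; x∈p∪q⁺; x∈p∪q⁻; ∣⁅x⁆∣≡1; ∣⊥∣≡0; ∉⊥)
open import Data.Vec using (_∷_) renaming ([] to []ᵛ)
open import Data.Bool using (true; false)
open import Data.List using (List; []; _∷_; [_]; _++_; length; map; reverse; lookup; applyUpTo)
open import Data.List.Properties
  using (length-map; length-++; length-applyUpTo; length-reverse; reverse-involutive; unfold-reverse; reverse-++; reverse-map; foldr-preservesᵇ)
open import Data.List.Membership.Propositional using (_∈_)
open import Data.List.Membership.Propositional.Properties using (∈-map⁺; ∈-map⁻; ∈-++⁺ˡ; ∈-++⁺ʳ; ∈-++⁻; ∈-applyUpTo⁺)
open import Data.List.Relation.Unary.Any using (here; there)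
open import Data.List.Relation.Unary.All as All using (All; []; _∷_)
import Data.List.Relation.Unary.All.Properties as All
open import Data.Product as Product using (∃; _×_; _,_; proj₁; proj₂)
open import Data.Sum as Sum using (_⊎_; inj₁; inj₂; [_,_]′)
open import Data.Unit using (⊤; tt)
open import Data.Empty using (⊥)
open import Function using (id; _∘_)
open import Function.Bundles using (_⇔_; mk⇔; Equivalence)
open import Relation.Binary.Definitions using (DecidableEquality)
open import Relation.Binary.PropositionalEquality using (_≡_; _≢_; refl; sym; trans; cong; subst; subst₂)
open import Relation.Binary.Construct.Closure.ReflexiveTransitive using (Star; ε; _◅_; gmap)
open import Relation.Nullary using (yes; no; contradiction)

private variable
  A : Set
  x y u v : A
  C : Set
  B : List A
  D E : List (List A)
  i j l n m o c w c₁ n₁ n₂ m₁ m₂ : ℕ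

-- Bags and interpolation

data Occurs {A : Set} (x : A) : List (List A) → ℕ → Set where
  here  : ∀ {B D} → x ∈ B → Occurs x (B ∷ D) 0
  there : ∀ {B D j} → Occurs x D j → Occurs x (B ∷ D) (suc j)

First Last : A → List (List A) → Set
First x D = Occurs x D 0
Last x D = First x (reverse D)

CoOccur : List (List A) → A → A → Set
CoOccur D x y = ∃ λ j → Occurs x D j × Occurs y D j

Interpolating : List (List A) → Set
Interpolating D = ∀ {x i j l} → i ≤ j → j ≤ l → Occurs x D i → Occurs x D l → Occurs x D j

Junction : List (List A) → List (List A) → Set
Junction D E = ∀ {x i j} → Occurs x D i → Occurs x E j → Last x D × First x E

Occurs-< : Occurs x D j → j < length D
Occurs-< (here _) = s≤s z≤n
Occurs-< (there o) = s≤s (Occurs-< o)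

Occurs-++ˡ : Occurs x D j → Occurs x (D ++ E) j
Occurs-++ˡ (here p) = here p
Occurs-++ˡ (there o) = there (Occurs-++ˡ o)

Occurs-++ʳ : ∀ D → Occurs x E j → Occurs x (D ++ E) (length D + j)
Occurs-++ʳ [] o = o
Occurs-++ʳ (_ ∷ D) o = there (Occurs-++ʳ D o)

Occurs-++⁻ : ∀ D → Occurs x (D ++ E) j → Occurs x D j ⊎ (length D ≤ j × Occurs x E (j ∸ length D))
Occurs-++⁻ [] o = inj₂ (z≤n , o)
Occurs-++⁻ (_ ∷ D) (here p) = inj₁ (here p)
Occurs-++⁻ (_ ∷ D) (there o) with Occurs-++⁻ D o
... | inj₁ oD = inj₁ (there oD)
... | inj₂ (d≤j , oE) = inj₂ (s≤s d≤j , oE)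

Occurs-++ʳ-∸ : ∀ D → length D ≤ j → Occurs x E (j ∸ length D) → Occurs x (D ++ E) j
Occurs-++ʳ-∸ D d≤j o = subst (Occurs _ _) (m+[n∸m]≡n d≤j) (Occurs-++ʳ D o)

CoOccur-++ˡ : CoOccur D x y → CoOccur (D ++ E) x y
CoOccur-++ˡ (j , ox , oy) = j , Occurs-++ˡ ox , Occurs-++ˡ oy

CoOccur-++ʳ : ∀ D → CoOccur E x y → CoOccur (D ++ E) x y
CoOccur-++ʳ D (j , ox , oy) = length D + j , Occurs-++ʳ D ox , Occurs-++ʳ D oy

Occurs-reverse⁺ : Occurs x D j → Occurs x (reverse D) (length D ∸ suc j)
Occurs-reverse⁺ {x = x} {D = B ∷ D} o = subst (λ E → Occurs x E _) (sym (unfold-reverse B D)) (snoc o)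
  where
  snoc : ∀ {j} → Occurs x (B ∷ D) j → Occurs x (reverse D ++ [ B ]) (length D ∸ j)
  snoc (here p) = subst (Occurs x _) (trans (+-identityʳ _) (length-reverse D)) (Occurs-++ʳ (reverse D) (here p))
  snoc (there o) = Occurs-++ˡ (Occurs-reverse⁺ o)

Occurs-reverse⁻ : Occurs x (reverse D) j → Occurs x D (length D ∸ suc j)
Occurs-reverse⁻ {x = x} {D = D} {j = j} o =
  subst₂ (λ E n → Occurs x E (n ∸ suc j)) (reverse-involutive D) (length-reverse D) (Occurs-reverse⁺ o)

Occurs-map⁺ : (f : A → C) → Occurs x D j → Occurs (f x) (map (map f) D) j
Occurs-map⁺ f (here p) = here (∈-map⁺ f p)
Occurs-map⁺ f (there o) = there (Occurs-map⁺ f o)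

Occurs-map⁻ : (f : A → C) → Occurs y (map (map f) D) j → ∃ λ x → f x ≡ y × Occurs x D j
Occurs-map⁻ {D = B ∷ D} f (here p) with ∈-map⁻ f p
... | x , x∈B , refl = x , refl , here x∈B
Occurs-map⁻ {D = B ∷ D} f (there o) with Occurs-map⁻ f o
... | x , refl , oD = x , refl , there oD

Occurs-singleton : Occurs x [ [ y ] ] j → x ≡ y
Occurs-singleton (here (here refl)) = refl

Interpolating-bridge : ∀ {k} → Interpolating D → i ≤ j → j ≤ l →
  Occurs x D i → Occurs x D k → Occurs y D k → Occurs y D l → Occurs x D j ⊎ Occurs y D j
Interpolating-bridge {j = j} {k = k} iD i≤j j≤l xi xk yk yl with ≤-total j k
... | inj₁ j≤k = inj₁ (iD i≤j j≤k xi xk)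
... | inj₂ k≤j = inj₂ (iD k≤j j≤l yk yl)

CoOccur-reverse : CoOccur D x y → CoOccur (reverse D) x y
CoOccur-reverse (j , ox , oy) = _ , Occurs-reverse⁺ ox , Occurs-reverse⁺ oy

Interpolating-[_] : (B : List A) → Interpolating [ B ]
Interpolating-[ B ] z≤n z≤n (here _) (here p) = here p

Interpolating-++ : ∀ D → Interpolating D → Interpolating E → Junction D E → Interpolating (D ++ E)
Interpolating-++ {E = E} D iD iE junction {j = j} i≤j j≤l oi ol
  with Occurs-++⁻ {E = E} D oi | Occurs-++⁻ {E = E} D ol
... | inj₁ di | inj₁ dl = Occurs-++ˡ (iD i≤j j≤l di dl)
... | inj₂ (d≤i , _) | inj₁ dl = contradiction (≤-trans d≤i (≤-trans i≤j j≤l)) (<⇒≱ (Occurs-< dl))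
... | inj₂ (d≤i , ei) | inj₂ (_ , el) =
  Occurs-++ʳ-∸ D (≤-trans d≤i i≤j) (iE (∸-monoˡ-≤ (length D) i≤j) (∸-monoˡ-≤ (length D) j≤l) ei el)
... | inj₁ di | inj₂ (_ , el) with junction di el | j <? length D
...   | lastD , _ | yes j<d = Occurs-++ˡ (iD i≤j (<⇒≤pred j<d) di (Occurs-reverse⁻ lastD))
...   | _ , firstE | no j≮d = Occurs-++ʳ-∸ D (≮⇒≥ j≮d) (iE z≤n (∸-monoˡ-≤ (length D) j≤l) firstE el)

∸-mirror : j < n → n ∸ suc (n ∸ suc j) ≡ j
∸-mirror {j = j} {n = n} j<n = trans (cong (n ∸_) (sym (+-∸-assoc 1 j<n))) (m∸[m∸n]≡n (<⇒≤ j<n))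

Interpolating-reverse : Interpolating D → Interpolating (reverse D)
Interpolating-reverse {D = D} iD {x} {j = j} i≤j j≤l oi ol =
  subst (Occurs x (reverse D)) (∸-mirror j<n)
    (Occurs-reverse⁺ (iD (∸-monoʳ-≤ (length D) (s≤s j≤l)) (∸-monoʳ-≤ (length D) (s≤s i≤j))
                         (Occurs-reverse⁻ ol) (Occurs-reverse⁻ oi)))
  where
  j<n : j < length D
  j<n = subst (j <_) (length-reverse D) (≤-<-trans j≤l (Occurs-< ol))

module _ {P : List A} where

  Occurs-suffixˡ : Occurs x D j → Occurs x (map (_++ P) D) j
  Occurs-suffixˡ (here p) = here (∈-++⁺ˡ p)
  Occurs-suffixˡ (there o) = there (Occurs-suffixˡ o)

  Occurs-suffixʳ : ∀ {D j} → x ∈ P → j < length (map (_++ P) D) → Occurs x (map (_++ P) D) j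
  Occurs-suffixʳ {D = B ∷ D} {zero} p _ = here (∈-++⁺ʳ B p)
  Occurs-suffixʳ {D = B ∷ D} {suc j} p (s≤s j<d) = there (Occurs-suffixʳ p j<d)

  Occurs-suffix⁻ : Occurs x (map (_++ P) D) j → Occurs x D j ⊎ x ∈ P
  Occurs-suffix⁻ {D = B ∷ D} (here p) = Sum.map₁ here (∈-++⁻ B p)
  Occurs-suffix⁻ {D = B ∷ D} (there o) = Sum.map₁ there (Occurs-suffix⁻ o)

  CoOccur-suffix : CoOccur D x y → CoOccur (map (_++ P) D) x y
  CoOccur-suffix (j , ox , oy) = j , Occurs-suffixˡ ox , Occurs-suffixˡ oy

  Interpolating-suffix : Interpolating D → Interpolating (map (_++ P) D)
  Interpolating-suffix iD i≤j j≤l oi ol with Occurs-suffix⁻ oi | Occurs-suffix⁻ ol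
  ... | inj₁ di | inj₁ dl = Occurs-suffixˡ (iD i≤j j≤l di dl)
  ... | inj₂ x∈P | _ = Occurs-suffixʳ x∈P (≤-<-trans j≤l (Occurs-< ol))
  ... | inj₁ _ | inj₂ x∈P = Occurs-suffixʳ x∈P (≤-<-trans j≤l (Occurs-< ol))

All-reverse : {Q : A → Set} {xs : List A} → All Q xs → All Q (reverse xs)
All-reverse [] = []
All-reverse {xs = x ∷ xs} (qx ∷ qxs) =
  subst (All _) (sym (unfold-reverse x xs)) (All.∷ʳ⁺ (All-reverse qxs) qx)

All-length-suffix : (P : List A) →
  All (λ B → length B ≤ suc m) D → All (λ B → length B ≤ suc (m + length P)) (map (_++ P) D)
All-length-suffix {m = m} P = All.map⁺ ∘ All.map λ {B} size →
  subst (_≤ suc (m + length P)) (sym (length-++ B)) (+-monoˡ-≤ (length P) size)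

Last-++ʳ : ∀ D E → Last x E → Last x (D ++ E)
Last-++ʳ D E o = subst (First _) (sym (reverse-++ D E)) (Occurs-++ˡ o)

Last-suffixˡ : (P : List A) (D : List (List A)) → Last x D → Last x (map (_++ P) D)
Last-suffixˡ P D o = subst (First _) (reverse-map (_++ P) D) (Occurs-suffixˡ o)

Last-suffixʳ : {P : List A} (D : List (List A)) → x ∈ P → Last y D → Last x (map (_++ P) D)
Last-suffixʳ {P = P} D x∈P o =
  subst (First _) (reverse-map (_++ P) D)
    (Occurs-suffixʳ x∈P (subst (0 <_) (sym (length-map _ (reverse D))) (Occurs-< o)))

module Update {A : Set} (_≟_ : DecidableEquality A) where

  _[_≔_] : (A → C) → A → C → A → C
  (f [ v ≔ u ]) w with w ≟ v
  ... | yes _ = u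
  ... | no _ = f w

  [≔]-same : (f : A → C) (v : A) → (f [ v ≔ y ]) v ≡ y
  [≔]-same f v with v ≟ v
  ... | yes _ = refl
  ... | no v≢v = contradiction refl v≢v

  [≔]-other : (f : A → C) → x ≢ v → (f [ v ≔ y ]) x ≡ f x
  [≔]-other {x = x} {v = v} f x≢v with x ≟ v
  ... | yes x≡v = contradiction x≡v x≢v
  ... | no _ = refl

  replace-cases : (x : A) → (x ≡ v × (id [ v ≔ u ]) x ≡ u) ⊎ (id [ v ≔ u ]) x ≡ x
  replace-cases {v = v} x with x ≟ v
  ... | yes x≡v = inj₁ (x≡v , refl)
  ... | no _ = inj₂ refl

  replace-≢ : u ≢ v → (x : A) → (id [ v ≔ u ]) x ≢ v
  replace-≢ {v = v} u≢v x with x ≟ v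
  ... | yes _ = u≢v
  ... | no x≢v = x≢v

  replace-fibre : (id [ v ≔ u ]) x ≡ (id [ v ≔ u ]) y → x ≡ y ⊎ (x ≡ u × y ≡ v) ⊎ (x ≡ v × y ≡ u)
  replace-fibre {v = v} {x = x} {y = y} eq with x ≟ v | y ≟ v
  ... | yes x≡v | yes y≡v = inj₁ (trans x≡v (sym y≡v))
  ... | yes x≡v | no _ = inj₂ (inj₂ (x≡v , sym eq))
  ... | no _ | yes y≡v = inj₂ (inj₁ (eq , y≡v))
  ... | no _ | no _ = inj₁ eq

  Interpolating-replace : Interpolating D → CoOccur D u v → Interpolating (map (map (id [ v ≔ u ])) D)
  Interpolating-replace {D = D} {u = u} {v = v} iD (_ , uk , vk) {j = j} i≤j j≤l oi ol
    with Occurs-map⁻ (id [ v ≔ u ]) oi | Occurs-map⁻ (id [ v ≔ u ]) ol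
  ... | a , refl , ai | b , fb≡fa , bl =
    [ Occurs-map⁺ f , subst (λ z → Occurs z (map (map f) D) j) fb≡fa ∘ Occurs-map⁺ f ]′
      (cases (replace-fibre (sym fb≡fa)))
    where
    f : A → A
    f = id [ v ≔ u ]
    cases : a ≡ b ⊎ (a ≡ u × b ≡ v) ⊎ (a ≡ v × b ≡ u) → Occurs a D j ⊎ Occurs b D j
    cases (inj₁ refl) = inj₁ (iD i≤j j≤l ai bl)
    cases (inj₂ (inj₁ (refl , refl))) = Interpolating-bridge iD i≤j j≤l ai uk vk bl
    cases (inj₂ (inj₂ (refl , refl))) = Interpolating-bridge iD i≤j j≤l ai vk uk bl

  -- v disappears from the renamed bags; the extra bag [ v ] keeps it covered.
  identify : A → A → List (List A) → List (List A)
  identify u v D = map (map (id [ v ≔ u ])) D ++ [ [ v ] ]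

  CoOccur-identify : CoOccur D x y → CoOccur (identify u v D) ((id [ v ≔ u ]) x) ((id [ v ≔ u ]) y)
  CoOccur-identify {u = u} {v = v} (j , ox , oy) =
    j , Occurs-++ˡ (Occurs-map⁺ (id [ v ≔ u ]) ox) , Occurs-++ˡ (Occurs-map⁺ (id [ v ≔ u ]) oy)

  Interpolating-identify : Interpolating D → CoOccur D u v → u ≢ v → Interpolating (identify u v D)
  Interpolating-identify {D = D} {u = u} {v = v} iD uv u≢v =
    Interpolating-++ _ (Interpolating-replace iD uv) Interpolating-[ [ v ] ] v-fresh
    where
    v-fresh : Junction (map (map (id [ v ≔ u ])) D) [ [ v ] ]
    v-fresh o o′ with Occurs-map⁻ (id [ v ≔ u ]) o
    ... | y , refl , _ = contradiction (Occurs-singleton o′) (replace-≢ u≢v y)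

open Update _≟_

-- Path decompositions of finite vertex sets

Bag : Set
Bag = List ℕ

record IsDecomposition (n m : ℕ) (D : List Bag) : Set where
  field
    interpolating : Interpolating D
    bag-size      : All (λ B → length B ≤ suc m) D
    covering      : ∀ {x} → x < n → ∃ (Occurs x D)
    bounded       : ∀ {x j} → Occurs x D j → x < n

IsDecomposition-identify : IsDecomposition n m D → CoOccur D u v → u ≢ v → IsDecomposition n m (identify u v D)
IsDecomposition-identify {n = n} {m = m} {D = D} {u = u} {v = v} isD uv@(_ , uk , vk) u≢v = record
  { interpolating = Interpolating-identify interpolating uv u≢v
  ; bag-size = All.++⁺ (All.map⁺ (All.map (λ {B} → subst (_≤ suc m) (sym (length-map f B))) bag-size))
                      (s≤s z≤n ∷ [])
  ; covering = covering′
  ; bounded = bounded′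
  }
  where
  open IsDecomposition isD
  f : ℕ → ℕ
  f = id [ v ≔ u ]
  covering′ : x < n → ∃ (Occurs x (identify u v D))
  covering′ {x = x} x<n with x ≟ v | covering x<n
  ... | yes refl | _ = _ , Occurs-++ʳ (map (map f) D) (here (here refl))
  ... | no x≢v | j , o = j , Occurs-++ˡ (subst (λ z → Occurs z _ j) ([≔]-other id x≢v) (Occurs-map⁺ f o))
  bounded′ : Occurs x (identify u v D) j → x < n
  bounded′ o with Occurs-++⁻ (map (map f) D) o
  ... | inj₂ (_ , o′) = subst (_< n) (sym (Occurs-singleton o′)) (bounded vk)
  ... | inj₁ o′ with Occurs-map⁻ f o′
  ...   | y , refl , oy with replace-cases {v = v} {u = u} y
  ...     | inj₁ (_ , fy≡u) = subst (_< n) (sym fy≡u) (bounded uk)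
  ...     | inj₂ fy≡y = subst (_< n) (sym fy≡y) (bounded oy)

Vertex : ℕ → ℕ → ℕ → ℕ → ℕ → Set
Vertex i o c n x = x ≡ i ⊎ x ≡ o ⊎ (c ≤ x × x < n)

Vertex-< : i < n → o < n → Vertex i o c n x → x < n
Vertex-< i<n _ (inj₁ refl) = i<n
Vertex-< _ o<n (inj₂ (inj₁ refl)) = o<n
Vertex-< _ _ (inj₂ (inj₂ (_ , x<n))) = x<n

Vertex-end : x < c → Vertex i o c n x → x ≡ i ⊎ x ≡ o
Vertex-end _ (inj₁ x≡i) = inj₁ x≡i
Vertex-end _ (inj₂ (inj₁ x≡o)) = inj₂ x≡o
Vertex-end x<c (inj₂ (inj₂ (c≤x , _))) = contradiction c≤x (<⇒≱ x<c)

Vertex-mono : c₁ ≤ c → n ≤ n₁ → Vertex i o c n x → Vertex i o c₁ n₁ x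
Vertex-mono c₁≤c n≤n₁ = Sum.map₂ (Sum.map₂ (Product.map (≤-trans c₁≤c) (λ x<n → <-≤-trans x<n n≤n₁)))

record IsDecompositionBetween (i o c n m : ℕ) (D : List Bag) : Set where
  field
    c≤n           : c ≤ n
    interpolating : Interpolating D
    bag-size      : All (λ B → length B ≤ suc m) D
    vertices      : ∀ {x j} → Occurs x D j → Vertex i o c n x
    covering      : ∀ {x} → c ≤ x → x < n → ∃ (Occurs x D)
    first         : First i D
    last          : Last o D

  bounded : i < c → o < c → Occurs x D j → x < n
  bounded i<c o<c = Vertex-< (<-≤-trans i<c c≤n) (<-≤-trans o<c c≤n) ∘ vertices

module _ {i₁ o₁ i₂ o₂ : ℕ} where

  shared-ends : i₁ < n₁ → o₁ < n₁ → i₂ < c → o₂ < c →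
    IsDecompositionBetween i₁ o₁ c n₁ m₁ D → IsDecompositionBetween i₂ o₂ n₁ n₂ m₂ E →
    Occurs x D j → Occurs x E l → (x ≡ i₁ ⊎ x ≡ o₁) × (x ≡ i₂ ⊎ x ≡ o₂)
  shared-ends i₁<n₁ o₁<n₁ i₂<c o₂<c isD isE xD xE = Vertex-end x<c (vertices isD xD) , ends₂
    where
    open IsDecompositionBetween
    ends₂ = Vertex-end (Vertex-< i₁<n₁ o₁<n₁ (vertices isD xD)) (vertices isE xE)
    x<c = [ (λ { refl → i₂<c }) , (λ { refl → o₂<c }) ]′ ends₂

between-single : 1 ≤ m → IsDecompositionBetween i o c c m [ i ∷ o ∷ [] ]
between-single 1≤m = record
  { c≤n = ≤-refl
  ; interpolating = Interpolating-[ _ ]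
  ; bag-size = s≤s 1≤m ∷ []
  ; vertices = λ { (here (here refl)) → inj₁ refl ; (here (there (here refl))) → inj₂ (inj₁ refl) }
  ; covering = λ c≤x x<c → contradiction c≤x (<⇒≱ x<c)
  ; first = here (here refl)
  ; last = here (there (here refl))
  }

between-weaken : m₁ ≤ m₂ → IsDecompositionBetween i o c n m₁ D → IsDecompositionBetween i o c n m₂ D
between-weaken m₁≤m₂ isD = record
  { c≤n = c≤n
  ; interpolating = interpolating
  ; bag-size = All.map (λ size → ≤-trans size (s≤s m₁≤m₂)) bag-size
  ; vertices = vertices
  ; covering = covering
  ; first = first
  ; last = last
  }
  where open IsDecompositionBetween isD

between-reverse : IsDecompositionBetween o i c n m D → IsDecompositionBetween i o c n m (reverse D)
between-reverse {D = D} isD = record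
  { c≤n = c≤n
  ; interpolating = Interpolating-reverse interpolating
  ; bag-size = All-reverse bag-size
  ; vertices = swap ∘ vertices ∘ Occurs-reverse⁻
  ; covering = λ c≤x x<n → let _ , o = covering c≤x x<n in _ , Occurs-reverse⁺ o
  ; first = last
  ; last = subst (First _) (sym (reverse-involutive D)) first
  }
  where
  open IsDecompositionBetween isD
  swap : Vertex o i c n x → Vertex i o c n x
  swap (inj₁ x≡o) = inj₂ (inj₁ x≡o)
  swap (inj₂ (inj₁ x≡i)) = inj₁ x≡i
  swap (inj₂ (inj₂ fresh)) = inj₂ (inj₂ fresh)

between-seq : i < c → o < c → i ≢ o →
  IsDecompositionBetween i c (suc c) n₁ m D → IsDecompositionBetween c o n₁ n₂ m E →
  IsDecompositionBetween i o c n₂ m (D ++ E)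
between-seq {i = i} {c = c} {o = o} {n₁ = n₁} {D = D} {n₂ = n₂} {E = E} i<c o<c i≢o isD isE = record
  { c≤n = ≤-trans (n≤1+n c) c+1≤n₂
  ; interpolating = Interpolating-++ D D.interpolating E.interpolating junction
  ; bag-size = All.++⁺ D.bag-size E.bag-size
  ; vertices = vertices
  ; covering = covering
  ; first = Occurs-++ˡ D.first
  ; last = Last-++ʳ D E E.last
  }
  where
  module D = IsDecompositionBetween isD
  module E = IsDecompositionBetween isE
  c+1≤n₂ : suc c ≤ n₂
  c+1≤n₂ = ≤-trans D.c≤n E.c≤n
  junction : Junction D E
  junction xD xE
    with shared-ends (<-≤-trans (m<n⇒m<1+n i<c) D.c≤n) D.c≤n (n<1+n c) (m<n⇒m<1+n o<c) isD isE xD xE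
  ... | _ , inj₁ refl = D.last , E.first
  ... | inj₂ refl , _ = D.last , E.first
  ... | inj₁ x≡i , inj₂ x≡o = contradiction (trans (sym x≡i) x≡o) i≢o
  fresh-c : x ≡ c → Vertex i o c n₂ x
  fresh-c refl = inj₂ (inj₂ (≤-refl , c+1≤n₂))
  vertices : Occurs x (D ++ E) j → Vertex i o c n₂ x
  vertices xDE with Occurs-++⁻ D xDE
  ... | inj₁ xD with D.vertices xD
  ...   | inj₁ x≡i = inj₁ x≡i
  ...   | inj₂ (inj₁ x≡c) = fresh-c x≡c
  ...   | inj₂ (inj₂ (c<x , x<n₁)) = inj₂ (inj₂ (<⇒≤ c<x , <-≤-trans x<n₁ E.c≤n))
  vertices xDE | inj₂ (_ , xE) with E.vertices xE
  ...   | inj₁ x≡c = fresh-c x≡c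
  ...   | inj₂ (inj₁ x≡o) = inj₂ (inj₁ x≡o)
  ...   | inj₂ (inj₂ (n₁≤x , x<n₂)) = inj₂ (inj₂ (≤-trans (≤-trans (n≤1+n c) D.c≤n) n₁≤x , x<n₂))
  covering : c ≤ x → x < n₂ → ∃ (Occurs x (D ++ E))
  covering {x = x} c≤x x<n₂ with m≤n⇒m<n∨m≡n c≤x
  ... | inj₂ refl = _ , Occurs-++ʳ D E.first
  ... | inj₁ c<x with x <? n₁
  ...   | yes x<n₁ = let _ , xD = D.covering c<x x<n₁ in _ , Occurs-++ˡ xD
  ...   | no x≮n₁ = let _ , xE = E.covering (≮⇒≥ x≮n₁) x<n₂ in _ , Occurs-++ʳ D xE

between-suffix : (P : Bag) → (∀ {x} → x ∈ P → x ≡ i ⊎ x ≡ o) →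
  IsDecompositionBetween i o c n m D → IsDecompositionBetween i o c n (m + length P) (map (_++ P) D)
between-suffix {D = D} P ends isD = record
  { c≤n = c≤n
  ; interpolating = Interpolating-suffix interpolating
  ; bag-size = All-length-suffix P bag-size
  ; vertices = [ vertices , Sum.map₂ inj₁ ∘ ends ]′ ∘ Occurs-suffix⁻
  ; covering = λ c≤x x<n → let _ , xD = covering c≤x x<n in _ , Occurs-suffixˡ xD
  ; first = Occurs-suffixˡ first
  ; last = Last-suffixˡ P D last
  }
  where open IsDecompositionBetween isD

between-++ : i < c → o < c → IsDecompositionBetween i o c n₁ m D → IsDecompositionBetween i o n₁ n₂ m E →
  Last i D → First o E → IsDecompositionBetween i o c n₂ m (D ++ E)
between-++ {i = i} {c = c} {o = o} {n₁ = n₁} {D = D} {n₂ = n₂} {E = E} i<c o<c isD isE last-i first-o = record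
  { c≤n = ≤-trans D.c≤n E.c≤n
  ; interpolating = Interpolating-++ D D.interpolating E.interpolating junction
  ; bag-size = All.++⁺ D.bag-size E.bag-size
  ; vertices = vertices
  ; covering = covering
  ; first = Occurs-++ˡ D.first
  ; last = Last-++ʳ D E E.last
  }
  where
  module D = IsDecompositionBetween isD
  module E = IsDecompositionBetween isE
  junction : Junction D E
  junction xD xE with proj₁ (shared-ends (<-≤-trans i<c D.c≤n) (<-≤-trans o<c D.c≤n) i<c o<c isD isE xD xE)
  ... | inj₁ refl = last-i , E.first
  ... | inj₂ refl = D.last , first-o
  vertices : Occurs x (D ++ E) j → Vertex i o c n₂ x
  vertices xDE with Occurs-++⁻ D xDE
  ... | inj₁ xD = Vertex-mono ≤-refl E.c≤n (D.vertices xD)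
  ... | inj₂ (_ , xE) = Vertex-mono D.c≤n ≤-refl (E.vertices xE)
  covering : c ≤ x → x < n₂ → ∃ (Occurs x (D ++ E))
  covering {x = x} c≤x x<n₂ with x <? n₁
  ... | yes x<n₁ = let _ , xD = D.covering c≤x x<n₁ in _ , Occurs-++ˡ xD
  ... | no x≮n₁ = let _ , xE = E.covering (≮⇒≥ x≮n₁) x<n₂ in _ , Occurs-++ʳ D xE

-- Both ends are shared by the two parts; adding i to every bag of the first and o to every bag
-- of the second makes both occur at the junction.
between-inter : i < c → o < c → 1 ≤ m₁ → 1 ≤ m₂ →
  IsDecompositionBetween i o c n₁ m₁ D → IsDecompositionBetween i o n₁ n₂ m₂ E →
  IsDecompositionBetween i o c n₂ (m₁ + m₂) (map (_++ [ i ]) D ++ map (_++ [ o ]) E)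
between-inter {i = i} {o = o} {m₁ = m₁} {m₂ = m₂} {D = D} {E = E} i<c o<c 1≤m₁ 1≤m₂ isD isE = between-++ i<c o<c
  (between-weaken (+-monoʳ-≤ m₁ 1≤m₂)
    (between-suffix [ i ] (λ { (here refl) → inj₁ refl }) isD))
  (between-weaken (≤-trans (≤-reflexive (+-comm m₂ 1)) (+-monoˡ-≤ m₂ 1≤m₁))
    (between-suffix [ o ] (λ { (here refl) → inj₂ refl }) isE))
  (Last-suffixʳ D (here refl) (IsDecompositionBetween.last isD))
  (Occurs-suffixʳ (here refl) (Occurs-< (Occurs-suffixˡ {P = [ o ]} (IsDecompositionBetween.first isE))))

between-close : i < c → o < c → (P : Bag) → (∀ {x} → x < c → x ≡ i ⊎ x ≡ o ⊎ x ∈ P) → All (_< n) P →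
  IsDecompositionBetween i o c n m D → IsDecomposition n (m + length P) (map (_++ P) D)
between-close {i = i} {c = c} {o = o} {n = n} {D = D} i<c o<c P below-c P<n isD = record
  { interpolating = Interpolating-suffix interpolating
  ; bag-size = All-length-suffix P bag-size
  ; covering = covering′
  ; bounded = bounded′
  }
  where
  open IsDecompositionBetween isD
  covering′ : x < n → ∃ (Occurs x (map (_++ P) D))
  covering′ {x = x} x<n with x <? c
  ... | no x≮c = let _ , xD = covering (≮⇒≥ x≮c) x<n in _ , Occurs-suffixˡ xD
  ... | yes x<c with below-c x<c
  ...   | inj₁ refl = _ , Occurs-suffixˡ first
  ...   | inj₂ (inj₁ refl) = _ , Occurs-suffixˡ (Occurs-reverse⁻ last)
  ...   | inj₂ (inj₂ x∈P) = _ , Occurs-suffixʳ x∈P (Occurs-< (Occurs-suffixˡ {P = P} first))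
  bounded′ : Occurs x (map (_++ P) D) j → x < n
  bounded′ xD′ with Occurs-suffix⁻ xD′
  ... | inj₁ xD = bounded i<c o<c xD
  ... | inj₂ x∈P = All.lookup P<n x∈P

module Contraction {A : Set} (n m : ℕ) (val : ℕ → A) where

  record Quotient (ρ : ℕ → ℕ) (D : List Bag) : Set where
    field
      isDecomposition : IsDecomposition n m D
      ρ<n             : ∀ {w} → w < n → ρ w < n
      val∘ρ           : ∀ w → val (ρ w) ≡ val w

  Quotient-identify : ∀ {ρ D} → Quotient ρ D → CoOccur D u v → u ≢ v → val u ≡ val v →
    Quotient ((id [ v ≔ u ]) ∘ ρ) (identify u v D)
  Quotient-identify {u = u} {v = v} {ρ = ρ} quot uv@(_ , uD , _) u≢v val-u≡val-v = record
    { isDecomposition = IsDecomposition-identify isDecomposition uv u≢v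
    ; ρ<n = ρ<n′
    ; val∘ρ = val∘ρ′
    }
    where
    open Quotient quot
    open IsDecomposition isDecomposition using (bounded)
    ρ<n′ : ∀ {w} → w < n → (id [ v ≔ u ]) (ρ w) < n
    ρ<n′ {w} w<n with replace-cases {v = v} {u = u} (ρ w)
    ... | inj₁ (_ , ρw↦u) = subst (_< n) (sym ρw↦u) (bounded uD)
    ... | inj₂ ρw↦ρw = subst (_< n) (sym ρw↦ρw) (ρ<n w<n)
    val∘ρ′ : ∀ w → val ((id [ v ≔ u ]) (ρ w)) ≡ val w
    val∘ρ′ w with replace-cases {v = v} {u = u} (ρ w)
    ... | inj₁ (ρw≡v , ρw↦u) =
      trans (cong val ρw↦u) (trans val-u≡val-v (trans (cong val (sym ρw≡v)) (val∘ρ w)))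
    ... | inj₂ ρw↦ρw = trans (cong val ρw↦ρw) (val∘ρ w)

  Mergeable : (ℕ → ℕ) → List Bag → ℕ × ℕ → Set
  Mergeable ρ D (p , q) = val p ≡ val q × CoOccur D (ρ p) (ρ q)

  record Contracted (ρ : ℕ → ℕ) (D : List Bag) (merges : List (ℕ × ℕ)) : Set where
    field
      f         : ℕ → ℕ
      D′        : List Bag
      quotient  : Quotient (f ∘ ρ) D′
      preserves : ∀ {a b} → CoOccur D a b → CoOccur D′ (f a) (f b)
      merged    : All (λ (p , q) → f (ρ p) ≡ f (ρ q)) merges

  contract : ∀ {ρ D} merges → Quotient ρ D → All (Mergeable ρ D) merges → Contracted ρ D merges
  contract [] quot [] = record { f = id ; D′ = _ ; quotient = quot ; preserves = id ; merged = [] }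
  contract {ρ = ρ} ((p , q) ∷ merges) quot ((val-p≡val-q , pq) ∷ mergeable) with ρ p ≟ ρ q
  ... | yes ρp≡ρq = record
    { f = R.f ; D′ = R.D′ ; quotient = R.quotient ; preserves = R.preserves
    ; merged = cong R.f ρp≡ρq ∷ R.merged
    }
    where module R = Contracted (contract merges quot mergeable)
  ... | no ρp≢ρq = record
    { f = R.f ∘ g ; D′ = R.D′ ; quotient = R.quotient ; preserves = R.preserves ∘ CoOccur-identify
    ; merged = cong R.f (trans ([≔]-other id ρp≢ρq) (sym ([≔]-same id (ρ q)))) ∷ R.merged
    }
    where
    open Quotient quot
    g : ℕ → ℕ
    g = id [ ρ q ≔ ρ p ]
    val-ρp≡val-ρq : val (ρ p) ≡ val (ρ q)
    val-ρp≡val-ρq = trans (val∘ρ p) (trans val-p≡val-q (sym (val∘ρ q)))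
    module R = Contracted (contract merges (Quotient-identify quot pq ρp≢ρq val-ρp≡val-ρq)
                                           (All.map (Product.map₂ CoOccur-identify) mergeable))

∣p∪q∣≤∣p∣+∣q∣ : (p q : Subset n) → ∣ p ∪ q ∣ ≤ ∣ p ∣ + ∣ q ∣
∣p∪q∣≤∣p∣+∣q∣ []ᵛ []ᵛ = z≤n
∣p∪q∣≤∣p∣+∣q∣ (true ∷ p) (true ∷ q) =
  s≤s (≤-trans (∣p∪q∣≤∣p∣+∣q∣ p q) (≤-trans (n≤1+n _) (≤-reflexive (sym (+-suc _ _)))))
∣p∪q∣≤∣p∣+∣q∣ (true ∷ p) (false ∷ q) = s≤s (∣p∪q∣≤∣p∣+∣q∣ p q)
∣p∪q∣≤∣p∣+∣q∣ (false ∷ p) (true ∷ q) = ≤-trans (s≤s (∣p∪q∣≤∣p∣+∣q∣ p q)) (≤-reflexive (sym (+-suc _ _)))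
∣p∪q∣≤∣p∣+∣q∣ (false ∷ p) (false ∷ q) = ∣p∪q∣≤∣p∣+∣q∣ p q

module _ {k : ℕ} where

  toFin : ℕ → Fin (suc k)
  toFin x = x mod suc k

  toℕ-toFin : x < suc k → toℕ (toFin x) ≡ x
  toℕ-toFin x<n = trans (Fin.toℕ-fromℕ< _) (m<n⇒m%n≡m x<n)

  toFin-toℕ : (p : Fin (suc k)) → toFin (toℕ p) ≡ p
  toFin-toℕ p = Fin.toℕ-injective (toℕ-toFin (Fin.toℕ<n p))

  toSubset : Bag → Subset (suc k)
  toSubset B = ⋃ (map (⁅_⁆ ∘ toFin) B)

  ∈-toSubset⁺ : x ∈ B → toFin x ∈ˢ toSubset B
  ∈-toSubset⁺ (here refl) = x∈p∪q⁺ (inj₁ (x∈⁅x⁆ _))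
  ∈-toSubset⁺ (there x∈B) = x∈p∪q⁺ (inj₂ (∈-toSubset⁺ x∈B))

  ∈-toSubset⁻ : ∀ {p} (B : Bag) → p ∈ˢ toSubset B → ∃ λ x → x ∈ B × p ≡ toFin x
  ∈-toSubset⁻ [] p∈∅ = contradiction p∈∅ ∉⊥
  ∈-toSubset⁻ (x ∷ B) p∈B with x∈p∪q⁻ ⁅ toFin x ⁆ (toSubset B) p∈B
  ... | inj₁ p∈⁅x⁆ = x , here refl , x∈⁅y⁆⇒x≡y _ p∈⁅x⁆
  ... | inj₂ p∈B′ with ∈-toSubset⁻ B p∈B′
  ...   | y , y∈B , refl = y , there y∈B , refl

  ∣toSubset∣≤length : (B : Bag) → ∣ toSubset B ∣ ≤ length B
  ∣toSubset∣≤length [] = ≤-reflexive (∣⊥∣≡0 (suc k))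
  ∣toSubset∣≤length (x ∷ B) = begin
    ∣ ⁅ toFin x ⁆ ∪ toSubset B ∣      ≤⟨ ∣p∪q∣≤∣p∣+∣q∣ ⁅ toFin x ⁆ (toSubset B) ⟩
    ∣ ⁅ toFin x ⁆ ∣ + ∣ toSubset B ∣  ≡⟨ cong (_+ ∣ toSubset B ∣) (∣⁅x⁆∣≡1 (toFin x)) ⟩
    suc ∣ toSubset B ∣               ≤⟨ s≤s (∣toSubset∣≤length B) ⟩
    suc (length B)                   ∎
    where open ≤-Reasoning

  lookup-toSubset⁺ : ∀ {p} (i : Fin (length (map toSubset D))) →
    Occurs (toℕ p) D (toℕ i) → p ∈ˢ lookup (map toSubset D) i
  lookup-toSubset⁺ {D = B ∷ D} {p} fzero (here p∈B) = subst (_∈ˢ toSubset B) (toFin-toℕ p) (∈-toSubset⁺ p∈B)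
  lookup-toSubset⁺ {D = B ∷ D} (fsuc i) (there o) = lookup-toSubset⁺ i o

  lookup-toSubset⁻ : (∀ {x j} → Occurs x D j → x < suc k) →
    ∀ {p} (i : Fin (length (map toSubset D))) → p ∈ˢ lookup (map toSubset D) i → Occurs (toℕ p) D (toℕ i)
  lookup-toSubset⁻ {D = B ∷ D} bounded fzero p∈B with ∈-toSubset⁻ B p∈B
  ... | x , x∈B , refl = here (subst (_∈ B) (sym (toℕ-toFin (bounded (here x∈B)))) x∈B)
  lookup-toSubset⁻ {D = B ∷ D} bounded (fsuc i) p∈D = there (lookup-toSubset⁻ (bounded ∘ there) i p∈D)

  CoOccur⇒lookup : ∀ {p q} → CoOccur D (toℕ p) (toℕ q) →
    ∃ λ i → p ∈ˢ lookup (map toSubset D) i × q ∈ˢ lookup (map toSubset D) i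
  CoOccur⇒lookup {D = D} (j , op , oq) = index , lookup-toSubset⁺ index (at op) , lookup-toSubset⁺ index (at oq)
    where
    index : Fin (length (map toSubset D))
    index = fromℕ< (subst (j <_) (sym (length-map toSubset D)) (Occurs-< op))
    at : Occurs y D j → Occurs y D (toℕ index)
    at = subst (Occurs _ D) (sym (Fin.toℕ-fromℕ< _))

  pathwidth≤ : {X : Set} (r : X → Fin (suc k) → Fin (suc k) → Set) →
    (∀ a p q → r a p q → p ≡ q ⊎ CoOccur D (toℕ p) (toℕ q)) →
    IsDecomposition (suc k) m D → PathwidthAtMost k r m
  pathwidth≤ {D = D} {m = m} r local isD = decomposition , width≤
    where
    open IsDecomposition isD
    bags : List (Subset (suc k))
    bags = map toSubset D
    cover : ∀ p → ∃ λ i → p ∈ˢ lookup bags i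
    cover p = let _ , o = covering (Fin.toℕ<n p) ; i , p∈ , _ = CoOccur⇒lookup (_ , o , o) in i , p∈
    edges : ∀ a p q → r a p q → ∃ λ i → p ∈ˢ lookup bags i × q ∈ˢ lookup bags i
    edges a p q rpq with local a p q rpq
    ... | inj₁ refl = let i , p∈ = cover p in i , p∈ , p∈
    ... | inj₂ pq = CoOccur⇒lookup pq
    decomposition : PathDecomposition k r
    decomposition = record
      { bags = bags
      ; cover = cover
      ; edges = edges
      ; interp = λ i j l i≤j j≤l p p∈i p∈l →
          lookup-toSubset⁺ j
            (interpolating i≤j j≤l (lookup-toSubset⁻ bounded i p∈i) (lookup-toSubset⁻ bounded l p∈l))
      }
    width≤ : width decomposition ≤ m
    width≤ = foldr-preservesᵇ {P = _≤ m} ⊔-lub z≤n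
      (All.map⁺ (All.map⁺ (All.map (λ {B} size → ∸-monoˡ-≤ 1 (≤-trans (∣toSubset∣≤length B) size)) bag-size)))

-- Structures, homomorphisms and pullbacks

⟦⟧-homomorphism : ∀ {X} {M N : Structure X} (g : Carrier M → Carrier N) →
  (∀ a {P Q} → rel M a P Q → rel N a (g P) (g Q)) →
  ∀ t {P Q} → ⟦ t ⟧ M P Q → ⟦ t ⟧ N (g P) (g Q)
⟦⟧-homomorphism g hom (atom a) p = hom a p
⟦⟧-homomorphism g hom one P≡Q = cong g P≡Q
⟦⟧-homomorphism g hom top _ = tt
⟦⟧-homomorphism g hom (t ⨾ s) (R , p , q) = g R , ⟦⟧-homomorphism g hom t p , ⟦⟧-homomorphism g hom s q
⟦⟧-homomorphism g hom (t ⊕ s) (inj₁ p) = inj₁ (⟦⟧-homomorphism g hom t p)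
⟦⟧-homomorphism g hom (t ⊕ s) (inj₂ q) = inj₂ (⟦⟧-homomorphism g hom s q)
⟦⟧-homomorphism g hom (t ∩ s) (p , q) = ⟦⟧-homomorphism g hom t p , ⟦⟧-homomorphism g hom s q
⟦⟧-homomorphism g hom (t ˘) p = ⟦⟧-homomorphism g hom t p
⟦⟧-homomorphism g hom (t *) p = gmap g (⟦⟧-homomorphism g hom t) p

module Pullback {V : Set} {nb nl : ℕ} {S : Structure (Var V nb nl)} (isS : IsRELTestsNoms S) {k : ℕ}
  (g : Fin (suc k) → Carrier S) (Adj : Fin (suc k) → Fin (suc k) → Set) (point : Fin nl → Fin (suc k))
  (g-point : ∀ l → rel S (nom l) (g (point l)) (g (point l))) where

  open IsRELTestsNoms isS

  -- Restricting variables to Adj-pairs makes every decomposition of Adj one of the pullback.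
  pullback : Var V nb nl → Fin (suc k) → Fin (suc k) → Set
  pullback (var a) p q = Adj p q × rel S (var a) (g p) (g q)
  pullback (tst b) p q = p ≡ q × rel S (tst b) (g p) (g q)
  pullback (ntst b) p q = p ≡ q × rel S (ntst b) (g p) (g q)
  pullback (nom l) p q = p ≡ point l × q ≡ point l

  isRELTestsNoms : IsRELTestsNoms (finStructure k pullback)
  isRELTestsNoms = record
    { tests-disjoint = λ b p q (_ , in-b) (_ , in-b̄) → tests-disjoint b (g p) (g q) in-b in-b̄
    ; tests-cover = λ b p q → mk⇔ [ proj₁ , proj₁ ]′
        (λ p≡q → Sum.map (p≡q ,_) (p≡q ,_) (Equivalence.from (tests-cover b (g p) (g q)) (cong g p≡q)))
    ; noms-singleton = λ l → point l , λ _ _ → mk⇔ id id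
    }

  homomorphism : ∀ a {p q} → pullback a p q → rel S a (g p) (g q)
  homomorphism (var a) = proj₂
  homomorphism (tst b) = proj₂
  homomorphism (ntst b) = proj₂
  homomorphism (nom l) (refl , refl) = g-point l

-- Unfolding a derivation into a graph

iw≥1 : {X : Set} (t : Term X) → 1 ≤ iw t
iw≥1 (atom _) = ≤-refl
iw≥1 one = ≤-refl
iw≥1 zero = ≤-refl
iw≥1 top = ≤-refl
iw≥1 (t ⨾ s) = ≤-trans (iw≥1 t) (m≤m⊔n _ _)
iw≥1 (t ⊕ s) = ≤-trans (iw≥1 t) (m≤m⊔n _ _)
iw≥1 (t ∩ s) = ≤-trans (iw≥1 t) (m≤m+n _ _)
iw≥1 (t ˘) = iw≥1 t
iw≥1 (t *) = iw≥1 t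

record Edge (X : Set) : Set where
  constructor edge
  field
    label  : X
    source : ℕ
    target : ℕ

open Edge

record Graph (X : Set) : Set where
  constructor mkGraph
  field
    edges  : List (Edge X)
    merges : List (ℕ × ℕ)

open Graph

_∪ᴳ_ : {X : Set} → Graph X → Graph X → Graph X
G ∪ᴳ H = mkGraph (edges G ++ edges H) (merges G ++ merges H)

Denotation : Set → Set₁
Denotation X = (M : Structure X) → Carrier M → Carrier M → Set

-- Vertices 0 and 1 are the ends of the derivation, 2 + l is the nominal l, and fresh vertices
-- are allocated from 2 + nl on.
nominalVertex : {nl : ℕ} → Fin nl → ℕ
nominalVertex l = 2 + toℕ l

module _ {V : Set} {nb nl : ℕ} where

  private
    X : Set
    X = Var V nb nl

  Models : (M : Structure X) → (ℕ → Carrier M) → Graph X → Set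
  Models M τ G = All (λ e → rel M (label e) (τ (source e)) (τ (target e))) (edges G)
               × All (λ (p , q) → τ p ≡ τ q) (merges G)
               × (∀ l → rel M (nom l) (τ (nominalVertex l)) (τ (nominalVertex l)))

  Models-∪ : ∀ M τ (G H : Graph X) → Models M τ (G ∪ᴳ H) → Models M τ G × Models M τ H
  Models-∪ _ _ G H (es , ms , ns) =
    (All.++⁻ˡ (edges G) es , All.++⁻ˡ (merges G) ms , ns) ,
    (All.++⁻ʳ (edges G) es , All.++⁻ʳ (merges G) ms , ns)

_⨾ᴰ_ _∩ᴰ_ : {X : Set} → Denotation X → Denotation X → Denotation X
(P ⨾ᴰ Q) M a b = ∃ λ z → P M a z × Q M z b
(P ∩ᴰ Q) M a b = P M a b × Q M a b

_˘ᴰ : {X : Set} → Denotation X → Denotation X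
(P ˘ᴰ) M a b = P M b a

module Construction {V : Set} {nb nl : ℕ} {S : Structure (Var V nb nl)} (isS : IsRELTestsNoms S) where

  open IsRELTestsNoms isS

  private
    X : Set
    X = Var V nb nl
    variable
      h : ℕ → Carrier S
      P Q : Denotation X
      G : Graph X

  nominalPoint : Fin nl → Carrier S
  nominalPoint l = proj₁ (noms-singleton l)

  WellShaped : Edge X → Set
  WellShaped (edge (var _) _ _) = ⊤
  WellShaped (edge (tst _) p q) = p ≡ q
  WellShaped (edge (ntst _) p q) = p ≡ q
  WellShaped (edge (nom _) _ _) = ⊥

  LegalEdge : (ℕ → Carrier S) → List Bag → Edge X → Set
  LegalEdge val D e =
    WellShaped e × rel S (label e) (val (source e)) (val (target e)) × CoOccur D (source e) (target e)

  data LegalMerge (val : ℕ → Carrier S) (D : List Bag) : ℕ × ℕ → Set where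
    local   : ∀ {p q} → val p ≡ val q → CoOccur D p q → LegalMerge val D (p , q)
    -- Nominal vertices are finally added to every bag, so such a merge needs no common bag.
    nominal : ∀ {p} l → val p ≡ nominalPoint l → CoOccur D p p → LegalMerge val D (p , nominalVertex l)

  Legal : (ℕ → Carrier S) → List Bag → Graph X → Set
  Legal val D G = All (LegalEdge val D) (edges G) × All (LegalMerge val D) (merges G)

  Legal-∪ : ∀ {val D} H → Legal val D G → Legal val D H → Legal val D (G ∪ᴳ H)
  Legal-∪ H (es , ms) (es′ , ms′) = All.++⁺ es es′ , All.++⁺ ms ms′

  Legal-transport : ∀ {val val′ D D′} → (∀ {x j} → Occurs x D j → val′ x ≡ val x) →
    (∀ {x y} → CoOccur D x y → CoOccur D′ x y) → Legal val D G → Legal val′ D′ G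
  Legal-transport {val = val} {val′} {D} {D′} agree embed (es , ms) =
    All.map legal-edge es , All.map legal-merge ms
    where
    legal-edge : ∀ {e} → LegalEdge val D e → LegalEdge val′ D′ e
    legal-edge {edge a _ _} (shape , r , pq@(_ , oP , oQ)) =
      shape , subst₂ (rel S a) (sym (agree oP)) (sym (agree oQ)) r , embed pq
    legal-merge : ∀ {pq} → LegalMerge val D pq → LegalMerge val′ D′ pq
    legal-merge (local eq pq@(_ , oP , oQ)) = local (trans (agree oP) (trans eq (sym (agree oQ)))) (embed pq)
    legal-merge (nominal l eq pp@(_ , oP , _)) = nominal l (trans (agree oP) eq) (embed pp)

  record Anchored (i o c : ℕ) (x y : Carrier S) (h : ℕ → Carrier S) : Set where
    field
      i<c : i < c
      o<c : o < c
      i≢o : i ≢ o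
      h-i : h i ≡ x
      h-o : h o ≡ y

  Anchored-swap : Anchored i o c x y h → Anchored o i c y x h
  Anchored-swap anc = record { i<c = o<c ; o<c = i<c ; i≢o = i≢o ∘ sym ; h-i = h-o ; h-o = h-i }
    where open Anchored anc

  record Unfolding (P : Denotation X) (m i o c : ℕ) (h : ℕ → Carrier S) : Set₁ where
    field
      next          : ℕ
      val           : ℕ → Carrier S
      val-agrees    : ∀ {x} → x < c → val x ≡ h x
      graph         : Graph X
      bags          : List Bag
      decomposition : IsDecompositionBetween i o c next m bags
      legal         : Legal val bags graph
      sound         : ∀ M τ → Models M τ graph → P M (τ i) (τ o)

    c≤next : c ≤ next
    c≤next = IsDecompositionBetween.c≤n decomposition

    bounded : i < c → o < c → Occurs x bags j → x < next
    bounded = IsDecompositionBetween.bounded decomposition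

  Unfolding-map : (∀ M {a b} → P M a b → Q M a b) → m₁ ≤ m₂ → Unfolding P m₁ i o c h → Unfolding Q m₂ i o c h
  Unfolding-map P⊆Q m₁≤m₂ U = record
    { next = next ; val = val ; val-agrees = val-agrees ; graph = graph ; bags = bags
    ; decomposition = between-weaken m₁≤m₂ decomposition ; legal = legal
    ; sound = λ M τ models → P⊆Q M (sound M τ models)
    }
    where open Unfolding U

  base : 1 ≤ m → (G : Graph X) → Legal h [ i ∷ o ∷ [] ] G →
    (∀ M τ → Models M τ G → P M (τ i) (τ o)) → Unfolding P m i o c h
  base {h = h} 1≤m G legal sound = record
    { next = _ ; val = h ; val-agrees = λ _ → refl ; graph = G ; bags = _
    ; decomposition = between-single 1≤m ; legal = legal ; sound = sound
    }

  CoOccur-ends : CoOccur [ i ∷ o ∷ [] ] i o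
  CoOccur-ends = 0 , here (here refl) , here (there (here refl))

  converse : Unfolding P m o i c h → Unfolding (P ˘ᴰ) m i o c h
  converse U = record
    { next = next ; val = val ; val-agrees = val-agrees ; graph = graph ; bags = reverse bags
    ; decomposition = between-reverse decomposition ; legal = Legal-transport (λ _ → refl) CoOccur-reverse legal
    ; sound = sound
    }
    where open Unfolding U

  seq : (z : Carrier S) → Anchored i o c x y h →
    (∀ {h₁} → Anchored i c (suc c) x z h₁ → Unfolding P m i c (suc c) h₁) →
    (∀ {c₁ h₂} → Anchored c o c₁ z y h₂ → Unfolding Q m c o c₁ h₂) →
    Unfolding (P ⨾ᴰ Q) m i o c h
  seq {i = i} {o = o} {c = c} {h = h} z anc first second = record
    { next = U₂.next
    ; val = U₂.val
    ; val-agrees = λ x<c → trans (U₂.val-agrees (<-≤-trans (m<n⇒m<1+n x<c) U₁.c≤next))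
                             (trans (U₁.val-agrees (m<n⇒m<1+n x<c)) ([≔]-other h (<⇒≢ x<c)))
    ; graph = U₁.graph ∪ᴳ U₂.graph
    ; bags = U₁.bags ++ U₂.bags
    ; decomposition = between-seq i<c o<c i≢o U₁.decomposition U₂.decomposition
    ; legal = Legal-∪ U₂.graph
        (Legal-transport (U₂.val-agrees ∘ U₁.bounded (m<n⇒m<1+n i<c) (n<1+n c)) CoOccur-++ˡ U₁.legal)
        (Legal-transport (λ _ → refl) (CoOccur-++ʳ U₁.bags) U₂.legal)
    ; sound = λ M τ models → let models₁ , models₂ = Models-∪ M τ U₁.graph U₂.graph models in
        τ c , U₁.sound M τ models₁ , U₂.sound M τ models₂
    }
    where
    open Anchored anc
    U₁ = first {h [ c ≔ z ]} record
      { i<c = m<n⇒m<1+n i<c ; o<c = n<1+n c ; i≢o = <⇒≢ i<c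
      ; h-i = trans ([≔]-other h (<⇒≢ i<c)) h-i ; h-o = [≔]-same h c }
    module U₁ = Unfolding U₁
    U₂ = second record
      { i<c = U₁.c≤next ; o<c = <-≤-trans (m<n⇒m<1+n o<c) U₁.c≤next ; i≢o = <⇒≢ o<c ∘ sym
      ; h-i = trans (U₁.val-agrees (n<1+n c)) ([≔]-same h c)
      ; h-o = trans (U₁.val-agrees (m<n⇒m<1+n o<c)) (trans ([≔]-other h (<⇒≢ o<c)) h-o) }
    module U₂ = Unfolding U₂

  inter : 1 ≤ m₁ → 1 ≤ m₂ → Anchored i o c x y h → Unfolding P m₁ i o c h →
    (∀ {c₁ h₁} → Anchored i o c₁ x y h₁ → Unfolding Q m₂ i o c₁ h₁) →
    Unfolding (P ∩ᴰ Q) (m₁ + m₂) i o c h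
  inter {i = i} {o = o} 1≤m₁ 1≤m₂ anc U₁ second = record
    { next = U₂.next
    ; val = U₂.val
    ; val-agrees = λ x<c → trans (U₂.val-agrees (<-≤-trans x<c U₁.c≤next)) (U₁.val-agrees x<c)
    ; graph = U₁.graph ∪ᴳ U₂.graph
    ; bags = map (_++ [ i ]) U₁.bags ++ map (_++ [ o ]) U₂.bags
    ; decomposition = between-inter i<c o<c 1≤m₁ 1≤m₂ U₁.decomposition U₂.decomposition
    ; legal = Legal-∪ U₂.graph
        (Legal-transport (U₂.val-agrees ∘ U₁.bounded i<c o<c) (CoOccur-++ˡ ∘ CoOccur-suffix) U₁.legal)
        (Legal-transport (λ _ → refl) (CoOccur-++ʳ (map (_++ [ i ]) U₁.bags) ∘ CoOccur-suffix) U₂.legal)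
    ; sound = λ M τ models → let models₁ , models₂ = Models-∪ M τ U₁.graph U₂.graph models in
        U₁.sound M τ models₁ , U₂.sound M τ models₂
    }
    where
    open Anchored anc
    module U₁ = Unfolding U₁
    U₂ = second record
      { i<c = <-≤-trans i<c U₁.c≤next ; o<c = <-≤-trans o<c U₁.c≤next ; i≢o = i≢o
      ; h-i = trans (U₁.val-agrees i<c) h-i ; h-o = trans (U₁.val-agrees o<c) h-o }
    module U₂ = Unfolding U₂

  reflexive : 1 ≤ m → (∀ M {a} → P M a a) → x ≡ y → Anchored i o c x y h → Unfolding P m i o c h
  reflexive {P = P} {i = i} 1≤m P-refl x≡y anc = base 1≤m (mkGraph [] [ (i , _) ])
    ([] , local (trans h-i (trans x≡y (sym h-o))) CoOccur-ends ∷ [])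
    (λ M τ (_ , ms , _) → subst (P M (τ i)) (All.head ms) (P-refl M))
    where open Anchored anc

  loop : (a : X) → (∀ {p} → WellShaped (edge a p p)) → rel S a x y → x ≡ y →
    Anchored i o c x y h → Unfolding ⟦ atom a ⟧ 1 i o c h
  loop {i = i} a shape r x≡y anc = base ≤-refl (mkGraph [ edge a i i ] [ (i , _) ])
    ((shape , subst₂ (rel S a) (sym h-i) (sym (trans h-i x≡y)) r , _ , here (here refl) , here (here refl)) ∷ [] ,
     local (trans h-i (trans x≡y (sym h-o))) CoOccur-ends ∷ [])
    (λ M τ (es , ms , _) → subst (rel M a (τ i)) (All.head ms) (All.head es))
    where open Anchored anc

  nominal-atom : ∀ l → rel S (nom l) x y → Anchored i o c x y h → Unfolding ⟦ atom (nom l) ⟧ 1 i o c h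
  nominal-atom {x = x} {y = y} {i = i} {o = o} l r anc =
    base ≤-refl (mkGraph [] ((i , nominalVertex l) ∷ (o , nominalVertex l) ∷ []))
      ([] , nominal l (trans h-i x≡point) (_ , i∈ , i∈) ∷ nominal l (trans h-o y≡point) (_ , o∈ , o∈) ∷ [])
      (λ { M τ (_ , i≡ ∷ o≡ ∷ [] , nominals) → subst₂ (rel M (nom l)) (sym i≡) (sym o≡) (nominals l) })
    where
    open Anchored anc
    i∈ = here (here refl)
    o∈ = here (there (here refl))
    x≡point = proj₁ (Equivalence.to (proj₂ (noms-singleton l) x y) r)
    y≡point = proj₂ (Equivalence.to (proj₂ (noms-singleton l) x y) r)

  build : (t : Term X) → ⟦ t ⟧ S x y → Anchored i o c x y h → Unfolding ⟦ t ⟧ (iw t) i o c h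
  build-star : (t : Term X) → Star (⟦ t ⟧ S) x y → Anchored i o c x y h → Unfolding ⟦ t * ⟧ (iw t) i o c h

  build (atom (var a)) r anc = base ≤-refl (mkGraph [ edge (var a) _ _ ] [])
    ((tt , subst₂ (rel S (var a)) (sym h-i) (sym h-o) r , CoOccur-ends) ∷ [] , [])
    (λ M τ (es , _) → All.head es)
    where open Anchored anc
  build (atom (tst b)) r = loop (tst b) refl r (Equivalence.to (tests-cover b _ _) (inj₁ r))
  build (atom (ntst b)) r = loop (ntst b) refl r (Equivalence.to (tests-cover b _ _) (inj₂ r))
  build (atom (nom l)) r = nominal-atom l r
  build one x≡y = reflexive ≤-refl (λ _ → refl) x≡y
  build zero ()
  build top _ _ = base ≤-refl (mkGraph [] []) ([] , []) (λ _ _ _ → tt)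
  build (t ⨾ s) (z , r₁ , r₂) anc = seq z anc
    (λ anc₁ → Unfolding-map (λ _ → id) (m≤m⊔n _ _) (build t r₁ anc₁))
    (λ anc₂ → Unfolding-map (λ _ → id) (m≤n⊔m _ _) (build s r₂ anc₂))
  build (t ⊕ s) (inj₁ r) anc = Unfolding-map (λ _ → inj₁) (m≤m⊔n _ _) (build t r anc)
  build (t ⊕ s) (inj₂ r) anc = Unfolding-map (λ _ → inj₂) (m≤n⊔m _ _) (build s r anc)
  build (t ∩ s) (r₁ , r₂) anc = inter (iw≥1 t) (iw≥1 s) anc (build t r₁ anc) (build s r₂)
  build (t ˘) r anc = converse (build t r (Anchored-swap anc))
  build (t *) r = build-star t r

  build-star t ε = reflexive (iw≥1 t) (λ _ → ε) refl
  build-star t (_◅_ {j = z} r rs) anc =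
    Unfolding-map (λ _ (_ , p , ps) → p ◅ ps) ≤-refl (seq z anc (build t r) (build-star t rs))

-- The finite model

module FiniteModel {V : Set} {nb nl : ℕ} {S : Structure (Var V nb nl)} (isS : IsRELTestsNoms S)
  (t : Term (Var V nb nl)) {x y : Carrier S} (t-xy : ⟦ t ⟧ S x y) where

  open IsRELTestsNoms isS
  open Construction isS

  initial : ℕ → Carrier S
  initial 0 = x
  initial 1 = y
  initial (suc (suc w)) with w <? nl
  ... | yes w<nl = nominalPoint (fromℕ< w<nl)
  ... | no _ = x    -- never used: fresh vertices get their values from the unfolding

  initial-nominal : ∀ l → initial (nominalVertex l) ≡ nominalPoint l
  initial-nominal l with toℕ l <? nl
  ... | yes l<nl = cong nominalPoint (Fin.fromℕ<-toℕ l l<nl)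
  ... | no l≮nl = contradiction (Fin.toℕ<n l) l≮nl

  U : Unfolding ⟦ t ⟧ (iw t) 0 1 (2 + nl) initial
  U = build t t-xy (record { i<c = s≤s z≤n ; o<c = s≤s (s≤s z≤n) ; i≢o = λ () ; h-i = refl ; h-o = refl })

  open Unfolding U

  k : ℕ
  k = pred next

  suc-k≡next : suc k ≡ next
  suc-k≡next = suc-pred next {{>-nonZero (≤-trans (s≤s z≤n) c≤next)}}

  <next⇒<suc-k : w < next → w < suc k
  <next⇒<suc-k = subst (_ <_) (sym suc-k≡next)

  vertex< : Occurs w bags j → w < suc k
  vertex< = <next⇒<suc-k ∘ bounded (s≤s z≤n) (s≤s (s≤s z≤n))

  nominals : Bag
  nominals = applyUpTo (2 +_) nl

  nominal∈ : ∀ l → nominalVertex l ∈ nominals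
  nominal∈ l = ∈-applyUpTo⁺ (2 +_) (Fin.toℕ<n l)

  val-nominal : ∀ l → val (nominalVertex l) ≡ nominalPoint l
  val-nominal l = trans (val-agrees (s≤s (s≤s (Fin.toℕ<n l)))) (initial-nominal l)

  below : w < 2 + nl → w ≡ 0 ⊎ w ≡ 1 ⊎ w ∈ nominals
  below {0} _ = inj₁ refl
  below {1} _ = inj₂ (inj₁ refl)
  below {suc (suc w)} (s≤s (s≤s w<nl)) = inj₂ (inj₂ (∈-applyUpTo⁺ (2 +_) w<nl))

  D₀ : List Bag
  D₀ = map (_++ nominals) bags

  decomposition₀ : IsDecomposition (suc k) (iw t + nl) D₀
  decomposition₀ =
    subst₂ (λ n m → IsDecomposition n m D₀) (sym suc-k≡next) (cong (iw t +_) (length-applyUpTo _ nl))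
    (between-close (s≤s z≤n) (s≤s (s≤s z≤n)) nominals below
      (All.applyUpTo⁺₁ (2 +_) nl (λ w<nl → <-≤-trans (s≤s (s≤s w<nl)) c≤next)) decomposition)

  open Contraction (suc k) (iw t + nl) val

  mergeable : All (Mergeable id D₀) (merges graph)
  mergeable = All.map legal⇒mergeable (proj₂ legal)
    where
    legal⇒mergeable : ∀ {pq} → LegalMerge val bags pq → Mergeable id D₀ pq
    legal⇒mergeable (local eq pq) = eq , CoOccur-suffix pq
    legal⇒mergeable (nominal l eq (j , p∈ , _)) =
      trans eq (sym (val-nominal l)) ,
      j , Occurs-suffixˡ p∈ , Occurs-suffixʳ (nominal∈ l) (Occurs-< (Occurs-suffixˡ p∈))

  quotient₀ : Quotient id D₀
  quotient₀ = record { isDecomposition = decomposition₀ ; ρ<n = id ; val∘ρ = λ _ → refl }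

  open Contracted (contract (merges graph) quotient₀ mergeable)
  open Quotient quotient

  τ : ℕ → Fin (suc k)
  τ w = toFin (f w)

  g : Fin (suc k) → Carrier S
  g p = val (toℕ p)

  g∘τ : w < suc k → g (τ w) ≡ val w
  g∘τ {w} w<n = trans (cong val (toℕ-toFin (ρ<n w<n))) (val∘ρ w)

  g-point : ∀ l → rel S (nom l) (g (τ (nominalVertex l))) (g (τ (nominalVertex l)))
  g-point l = subst (λ z → rel S (nom l) z z) (sym (trans (g∘τ nominal<) (val-nominal l)))
    (Equivalence.from (proj₂ (noms-singleton l) _ _) (refl , refl))
    where
    nominal< : nominalVertex l < suc k
    nominal< = <next⇒<suc-k (<-≤-trans (s≤s (s≤s (Fin.toℕ<n l))) c≤next)

  Adjacent : Fin (suc k) → Fin (suc k) → Set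
  Adjacent p q = CoOccur D′ (toℕ p) (toℕ q)

  open Pullback isS g Adjacent (τ ∘ nominalVertex) g-point public

  F : Structure (Var V nb nl)
  F = finStructure k pullback

  edge-holds : ∀ {e} → LegalEdge val bags e → rel F (label e) (τ (source e)) (τ (target e))
  edge-holds {edge a p q} (shape , r , pq@(_ , p∈ , q∈)) = in-F a shape r
    where
    p<n = vertex< p∈
    q<n = vertex< q∈
    along-g : ∀ a → rel S a (val p) (val q) → rel S a (g (τ p)) (g (τ q))
    along-g a = subst₂ (rel S a) (sym (g∘τ p<n)) (sym (g∘τ q<n))
    adjacent : Adjacent (τ p) (τ q)
    adjacent = subst₂ (CoOccur D′) (sym (toℕ-toFin (ρ<n p<n))) (sym (toℕ-toFin (ρ<n q<n)))
                 (preserves (CoOccur-suffix pq))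
    in-F : ∀ a → WellShaped (edge a p q) → rel S a (val p) (val q) → pullback a (τ p) (τ q)
    in-F (var a) _ r = adjacent , along-g (var a) r
    in-F (tst b) refl r = refl , along-g (tst b) r
    in-F (ntst b) refl r = refl , along-g (ntst b) r

  models : Models F τ graph
  models = All.map edge-holds (proj₁ legal) , All.map (cong toFin) merged , λ _ → refl , refl

  holds : ⟦ t ⟧ F (τ 0) (τ 1)
  holds = sound F τ models

  pathwidth : PathwidthAtMost k pullback (iw t + nl)
  pathwidth = pathwidth≤ pullback loop-or-adjacent isDecomposition
    where
    loop-or-adjacent : ∀ a p q → pullback a p q → p ≡ q ⊎ Adjacent p q
    loop-or-adjacent (var _) _ _ = inj₂ ∘ proj₁
    loop-or-adjacent (tst _) _ _ = inj₁ ∘ proj₁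
    loop-or-adjacent (ntst _) _ _ = inj₁ ∘ proj₁
    loop-or-adjacent (nom _) _ _ (p≡ , q≡) = inj₁ (trans p≡ (sym q≡))

  transfer : ∀ s → ⟦ s ⟧ F (τ 0) (τ 1) → ⟦ s ⟧ S x y
  transfer s =
    subst₂ (⟦ s ⟧ S) (end 0 (s≤s z≤n)) (end 1 (s≤s (s≤s z≤n))) ∘ ⟦⟧-homomorphism g homomorphism s
    where
    end : ∀ w → w < 2 + nl → g (τ w) ≡ initial w
    end w w<c = trans (g∘τ (<next⇒<suc-k (<-≤-trans w<c c≤next))) (val-agrees w<c)

proposition6p2 : (V : Set) (nb nl : ℕ) (t s : Term (Var V nb nl)) →
    ((S : Structure (Var V nb nl)) → IsRELTestsNoms S → Holds≤ S t s)
    ⇔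
    ((k : ℕ) (r : Var V nb nl → Fin (suc k) → Fin (suc k) → Set) →
       IsRELTestsNoms (finStructure k r) → PathwidthAtMost k r (iw t + nl) →
       Holds≤ (finStructure k r) t s)
proposition6p2 V nb nl t s = mk⇔
  (λ valid k r isF _ → valid (finStructure k r) isF)
  (λ valid-small S isS x y t-xy → let open FiniteModel isS t t-xy in
    transfer s (valid-small k pullback isRELTestsNoms pathwidth (τ 0) (τ 1) holds))
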